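{- Let $A,B,\alpha,\beta,\gamma\ge 0$ and let $\{f_{m,n}\}_{m,n\ge0}$ be defined by $f_{m,n}=A^mB^n$ if $mn=0$ (with $0^0=1$), and $f_{m,n}=\alpha f_{m-1,n}+\beta f_{m,n-1}+\gamma f_{m-1,n-1}$ if $mn>0$. Then: (i) if $\alpha\beta\neq0$, $f_{m,n}=A^mB^n$ for all $m,n\ge0$ if and only if $AB=\beta A+\alpha B+\gamma$; (ii) if $\alpha=0\neq\beta$, $f_{m,n}=A^mB^n$ for all $m,n\ge0$ if and only if $AB=\beta A+\gamma$; (iii) if $\alpha\neq0=\beta$, $f_{m,n}=A^mB^n$ for all $m,n\ge0$ if and only if $AB=\alpha B+\gamma$; (iv) if $\alpha=\beta=0$, $f_{m,n}=A^mB^n$ for all $m,n\ge0$ if and only if $AB=\gamma$. -}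

module Defs where

open import Level using (Level; _⊔_)
open import Data.Nat using (ℕ; zero; suc)
open import Algebra.Bundles using (CommutativeRing; Semiring)
open import Relation.Binary.Core using (Rel)
open import Relation.Binary.Structures using (IsTotalOrder)
import Algebra.Definitions.RawSemiring as RawSemiringDefs

-- A (totally) ordered commutative ring: the real numbers ℝ are an instance.
-- agda-stdlib has no real numbers, so the statement is made for every
-- such structure.
record OrderedCommutativeRing (c ℓ₁ ℓ₂ : Level) : Set (Level.suc (c ⊔ ℓ₁ ⊔ ℓ₂)) where
  field
    commutativeRing : CommutativeRing c ℓ₁
  open CommutativeRing commutativeRing public
  field
    _≤_            : Rel Carrier ℓ₂
    isTotalOrder   : IsTotalOrder _≈_ _≤_
    +-mono-≤       : ∀ {x y} z → x ≤ y → (x + z) ≤ (y + z)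
    *-nonneg       : ∀ {x y} → 0# ≤ x → 0# ≤ y → 0# ≤ (x * y)

module _ {c ℓ₁ ℓ₂} (R : OrderedCommutativeRing c ℓ₁ ℓ₂) where
  open OrderedCommutativeRing R hiding (zero)

  -- the library power: x ^ 0 = 1#, so 0^0 = 1
  pow : Carrier → ℕ → Carrier
  pow = RawSemiringDefs._^_ (Semiring.rawSemiring semiring)

  f : (A B α β γ : Carrier) → ℕ → ℕ → Carrier
  f A B α β γ zero    n       = pow A zero * pow B n
  f A B α β γ (suc m) zero    = pow A (suc m) * pow B zero
  f A B α β γ (suc m) (suc n) =
    ((α * f A B α β γ m (suc n)) + (β * f A B α β γ (suc m) n)) + (γ * f A B α β γ m n)

{-# OPTIONS --safe #-}
-- The monomials A^m B^n agree with f on the boundary, and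
-- substituting them into the recurrence at (m+1, n+1) leaves the common
-- factor A^m B^n times β A + α B + γ on the right against A^m B^n times A B
-- on the left; so they satisfy the recurrence everywhere iff
-- A B = β A + α B + γ, necessity being the instance f_{1,1}. The four cases
-- only drop the terms killed by α = 0 or β = 0.
module Submission where

open import Defs
open import Level using (Level)
open import Data.Nat using (ℕ; zero; suc)
open import Data.Product using (_×_; _,_)
open import Relation.Nullary using (¬_)
open import Function.Bundles using (_⇔_; mk⇔)
import Algebra.Solver.CommutativeMonoid as CommutativeMonoidSolver
import Relation.Binary.Reasoning.Setoid as SetoidReasoning

module _ {c ℓ₁ ℓ₂ : Level} (R : OrderedCommutativeRing c ℓ₁ ℓ₂) where
  open OrderedCommutativeRing R hiding (zero)
  open CommutativeMonoidSolver *-commutativeMonoid using (solve; _⊜_; _⊕_)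
  open SetoidReasoning setoid

  x≈0⇒x*y≈0 : ∀ {x} y → x ≈ 0# → x * y ≈ 0#
  x≈0⇒x*y≈0 y x≈0 = trans (*-congʳ x≈0) (zeroˡ y)

  module _ (A B α β γ : Carrier) where

    MonomialSolution : Set ℓ₁
    MonomialSolution = ∀ m n → f R A B α β γ m n ≈ pow R A m * pow R B n

    recurrence-on-monomials : ∀ a b →
      α * (a * (B * b)) + β * ((A * a) * b) + γ * (a * b) ≈ (a * b) * (β * A + α * B + γ)
    recurrence-on-monomials a b = begin
      α * (a * (B * b)) + β * ((A * a) * b) + γ * (a * b)
        ≈⟨ +-cong (+-cong αaBb≈abαB βAab≈abβA) (*-comm γ (a * b)) ⟩
      (a * b) * (α * B) + (a * b) * (β * A) + (a * b) * γ
        ≈⟨ +-congʳ (+-comm _ _) ⟩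
      (a * b) * (β * A) + (a * b) * (α * B) + (a * b) * γ
        ≈⟨ +-congʳ (distribˡ (a * b) (β * A) (α * B)) ⟨
      (a * b) * (β * A + α * B) + (a * b) * γ
        ≈⟨ distribˡ (a * b) (β * A + α * B) γ ⟨
      (a * b) * (β * A + α * B + γ) ∎
      where
      αaBb≈abαB : α * (a * (B * b)) ≈ (a * b) * (α * B)
      αaBb≈abαB = solve 4 (λ α B a b → α ⊕ (a ⊕ (B ⊕ b)) ⊜ (a ⊕ b) ⊕ (α ⊕ B)) refl α B a b
      βAab≈abβA : β * ((A * a) * b) ≈ (a * b) * (β * A)
      βAab≈abβA = solve 4 (λ β A a b → β ⊕ ((A ⊕ a) ⊕ b) ⊜ (a ⊕ b) ⊕ (β ⊕ A)) refl β A a b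

    monomial-solution⇒characteristic : MonomialSolution → A * B ≈ β * A + α * B + γ
    monomial-solution⇒characteristic solution = begin
      A * B
        ≈⟨ *-cong (*-identityʳ A) (*-identityʳ B) ⟨
      (A * 1#) * (B * 1#)
        ≈⟨ solution 1 1 ⟨
      f R A B α β γ 1 1
        ≈⟨ recurrence-on-monomials 1# 1# ⟩
      (1# * 1#) * (β * A + α * B + γ)
        ≈⟨ trans (*-congʳ (*-identityˡ 1#)) (*-identityˡ _) ⟩
      β * A + α * B + γ ∎

    characteristic⇒monomial-solution : A * B ≈ β * A + α * B + γ → MonomialSolution
    characteristic⇒monomial-solution AB≈ zero    n       = refl
    characteristic⇒monomial-solution AB≈ (suc m) zero    = refl
    characteristic⇒monomial-solution AB≈ (suc m) (suc n) = begin
      α * f R A B α β γ m (suc n) + β * f R A B α β γ (suc m) n + γ * f R A B α β γ m n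
        ≈⟨ +-cong (+-cong (*-congˡ (induct m (suc n))) (*-congˡ (induct (suc m) n)))
                  (*-congˡ (induct m n)) ⟩
      α * (a * (B * b)) + β * ((A * a) * b) + γ * (a * b)
        ≈⟨ recurrence-on-monomials a b ⟩
      (a * b) * (β * A + α * B + γ)
        ≈⟨ *-congˡ AB≈ ⟨
      (a * b) * (A * B)
        ≈⟨ solve 4 (λ A B a b → (a ⊕ b) ⊕ (A ⊕ B) ⊜ (A ⊕ a) ⊕ (B ⊕ b)) refl A B a b ⟩
      (A * a) * (B * b) ∎
      where
      a = pow R A m
      b = pow R B n
      induct : MonomialSolution
      induct = characteristic⇒monomial-solution AB≈

    monomial-solution⇔ : ∀ {z} → β * A + α * B + γ ≈ z → MonomialSolution ⇔ (A * B ≈ z)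
    monomial-solution⇔ ≈z = mk⇔
      (λ solution → trans (monomial-solution⇒characteristic solution) ≈z)
      (λ AB≈z → characteristic⇒monomial-solution (trans AB≈z (sym ≈z)))

corollary4p2 : ∀ {c ℓ₁ ℓ₂ : Level} (R : OrderedCommutativeRing c ℓ₁ ℓ₂) →
    let open OrderedCommutativeRing R in
    (A B α β γ : Carrier) →
    0# ≤ A → 0# ≤ B → 0# ≤ α → 0# ≤ β → 0# ≤ γ →
    (¬ (α * β ≈ 0#) →
      ((∀ (m n : ℕ) → f R A B α β γ m n ≈ pow R A m * pow R B n) ⇔ (A * B ≈ ((β * A) + (α * B)) + γ)))
    × ((α ≈ 0#) → ¬ (β ≈ 0#) →
      ((∀ (m n : ℕ) → f R A B α β γ m n ≈ pow R A m * pow R B n) ⇔ (A * B ≈ (β * A) + γ)))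
    × (¬ (α ≈ 0#) → β ≈ 0# →
      ((∀ (m n : ℕ) → f R A B α β γ m n ≈ pow R A m * pow R B n) ⇔ (A * B ≈ (α * B) + γ)))
    × (α ≈ 0# → β ≈ 0# →
      ((∀ (m n : ℕ) → f R A B α β γ m n ≈ pow R A m * pow R B n) ⇔ (A * B ≈ γ)))
corollary4p2 R A B α β γ _ _ _ _ _ =
    (λ _ → monomial-solution⇔ R A B α β γ refl)
  , (λ α≈0 _ → monomial-solution⇔ R A B α β γ (+-congʳ (βA+αB≈βA α≈0)))
  , (λ _ β≈0 → monomial-solution⇔ R A B α β γ (+-congʳ (βA+αB≈αB β≈0)))
  , (λ α≈0 β≈0 → monomial-solution⇔ R A B α β γ
       (trans (+-congʳ (trans (βA+αB≈αB β≈0) (x≈0⇒x*y≈0 R B α≈0))) (+-identityˡ γ)))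
  where
  open OrderedCommutativeRing R hiding (zero)

  βA+αB≈βA : α ≈ 0# → β * A + α * B ≈ β * A
  βA+αB≈βA α≈0 = trans (+-congˡ (x≈0⇒x*y≈0 R B α≈0)) (+-identityʳ (β * A))

  βA+αB≈αB : β ≈ 0# → β * A + α * B ≈ α * B
  βA+αB≈αB β≈0 = trans (+-congʳ (x≈0⇒x*y≈0 R A β≈0)) (+-identityˡ (α * B))
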